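{- Let $N$ be a square-free integer, let $E_N: y^2=x^3-N^2x$, and let $P\in E_N(\mathbb{Q})$ be a point of infinite order. Then $2P$ is not integral.
   Context: A point is integral if it is an affine point with integer coordinates. -}

module Defs where

open import Data.Nat using (ℕ; zero; suc)
open import Data.Integer as ℤ using (ℤ)
open import Data.Integer.Divisibility as ℤD using ()
open import Data.Rational as ℚ using (ℚ; 0ℚ; 1ℚ; _+_; _*_; _-_; 1/_; _≟_)
open import Data.Rational.Base using (≢-nonZero)
open import Data.Product using (Σ; ∃; _×_; _,_)
open import Data.Unit using (⊤)
open import Relation.Nullary using (¬_; yes; no)
open import Relation.Binary.PropositionalEquality using (_≡_; _≢_)

SquareFree : ℤ → Set
SquareFree N = (N ≢ ℤ.0ℤ) × (∀ (d : ℤ) → (d ℤ.* d) ℤD.∣ N → ℤ.∣ d ∣ ≡ 1)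

ι : ℤ → ℚ
ι a = a ℚ./ 1

data Point : Set where
  O   : Point
  aff : ℚ → ℚ → Point

coefA : ℤ → ℚ
coefA N = ℚ.- ι (N ℤ.* N)

OnCurve : ℤ → Point → Set
OnCurve N O         = ⊤
OnCurve N (aff x y) = y * y ≡ x * x * x - ι (N ℤ.* N) * x

-- total division (only ever used with a nonzero denominator on the curve)
div : ℚ → ℚ → ℚ
div p q with q ≟ 0ℚ
... | yes _  = 0ℚ
... | no q≢0 = p * (1/_ q {{≢-nonZero q≢0}})

-- standard chord-and-tangent group law on y² = x³ + a x + b
add : ℤ → Point → Point → Point
add N O Q = Q
add N (aff x₁ y₁) O = aff x₁ y₁
add N (aff x₁ y₁) (aff x₂ y₂) with x₁ ≟ x₂
... | no _ = third (div (y₂ - y₁) (x₂ - x₁))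
  where
  third : ℚ → Point
  third λ' = let x₃ = λ' * λ' - x₁ - x₂ in aff x₃ (λ' * (x₁ - x₃) - y₁)
... | yes _ with (y₁ + y₂) ≟ 0ℚ
...   | yes _ = O
...   | no _  = third (div (ι (ℤ.+ 3) * x₁ * x₁ + coefA N) (ι (ℤ.+ 2) * y₁))
  where
  third : ℚ → Point
  third λ' = let x₃ = λ' * λ' - x₁ - x₂ in aff x₃ (λ' * (x₁ - x₃) - y₁)

mul : ℤ → ℕ → Point → Point
mul N zero    P = O
mul N (suc n) P = add N P (mul N n P)

InfiniteOrder : ℤ → Point → Set
InfiniteOrder N P = ∀ (n : ℕ) → mul N (suc n) P ≢ O

Integral : Point → Set
Integral P = Σ ℤ λ a → Σ ℤ λ b → P ≡ aff (ι a) (ι b)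

-- Write 2P = (X, Y) with slope λ = (3x² − N²)/2y. Clearing λ² − 2x + c against
-- 4y² = 4(x³ − N²x) gives (λ² − 2x + c)·4y² = (3x² − N²)² − 4(2x − c)(x³ − N²x), which is
-- the square of x² + N², x² − 2Nx − N², x² + 2Nx − N² for c = 0, −N, N respectively.
-- So if X is an integer, then X − N, X, X + N are integer squares (a rational square
-- that is an integer is an integer square), and three squares in arithmetic progression
-- with difference N force 4 ∣ N by a parity count, contradicting square-freeness.
module Submission where

open import Defs
open import Data.Integer using (ℤ)
open import Relation.Nullary using (¬_)

open import Data.Empty using (⊥-elim)
open import Data.Integer as ℤ using (+_; +0; +[1+_]; -[1+_]; 1ℤ)
open import Data.Integer.DivMod using (_%ℕ_; _/ℕ_; n%ℕd<d; a≡a%ℕn+[a/ℕn]*n)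
open import Data.Integer.Divisibility.Signed using (_∣_; divides; ∣⇒∣ᵤ)
import Data.Integer.Properties as ℤ
import Data.Integer.Tactic.RingSolver as ℤ-Ring
open import Data.List using (_∷_; [])
open import Data.Nat as ℕ using (suc)
open import Data.Nat.Coprimality as Coprimality using (Coprime; coprime-divisor; recompute)
import Data.Nat.Divisibility as ℕ
open import Data.Product using (∃; _×_; _,_)
open import Data.Rational as ℚ using (ℚ; mkℚ; 0ℚ; 1ℚ; _+_; _*_; _-_; -_; 1/_; _≟_)
open import Data.Rational.Base using (≢-nonZero)
open import Data.Rational.Solver using (module +-*-Solver)
open import Data.Rational.Literals using (fromℤ)
import Data.Rational.Properties as ℚ
import Data.Rational.Unnormalised.Properties as ℚᵘ
open import Function using (_∘_)
open import Relation.Nullary using (yes; no)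
open import Relation.Binary.PropositionalEquality

open ≡-Reasoning
open +-*-Solver using (solve; Polynomial; _:+_; _:-_; :-_; _:*_; con; _:=_)

IsSquareℤ : ℤ → Set
IsSquareℤ a = ∃ λ m → m ℤ.* m ≡ a

IsSquareℚ : ℚ → Set
IsSquareℚ q = ∃ λ r → r * r ≡ q

data Parity : ℤ → Set where
  even : ∀ k → Parity (+ 2 ℤ.* k)
  odd  : ∀ k → Parity (+ 2 ℤ.* k ℤ.+ 1ℤ)

parity : ∀ z → Parity z
parity z = from-division (z %ℕ 2) (z /ℕ 2) (n%ℕd<d z 2) (a≡a%ℕn+[a/ℕn]*n z 2)
  where
  from-division : ∀ r q → r ℕ.< 2 → z ≡ + r ℤ.+ q ℤ.* + 2 → Parity z
  from-division 0 q _ eq = subst Parity (begin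
    + 2 ℤ.* q              ≡⟨ ℤ-Ring.solve (q ∷ []) ⟩
    + 0 ℤ.+ q ℤ.* + 2      ≡⟨ eq ⟨
    z                      ∎) (even q)
  from-division 1 q _ eq = subst Parity (begin
    + 2 ℤ.* q ℤ.+ 1ℤ       ≡⟨ ℤ-Ring.solve (q ∷ []) ⟩
    + 1 ℤ.+ q ℤ.* + 2      ≡⟨ eq ⟨
    z                      ∎) (odd q)
  from-division (suc (suc _)) _ (ℕ.s≤s (ℕ.s≤s ()))

odd≢even : ∀ k m → + 2 ℤ.* k ℤ.+ 1ℤ ≢ + 2 ℤ.* m
odd≢even k m eq with ℕ.∣1⇒≡1 (∣⇒∣ᵤ (divides (m ℤ.- k) 1≡[m-k]*2))
  where
  1≡[m-k]*2 : 1ℤ ≡ (m ℤ.- k) ℤ.* + 2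
  1≡[m-k]*2 = begin
    1ℤ                                    ≡⟨ ℤ-Ring.solve (k ∷ []) ⟩
    (+ 2 ℤ.* k ℤ.+ 1ℤ) ℤ.- + 2 ℤ.* k      ≡⟨ cong (ℤ._- + 2 ℤ.* k) eq ⟩
    + 2 ℤ.* m ℤ.- + 2 ℤ.* k               ≡⟨ ℤ-Ring.solve (k ∷ m ∷ []) ⟩
    (m ℤ.- k) ℤ.* + 2                     ∎
... | ()

4∣-by-parity : ∀ {U V W} → Parity U → Parity V → Parity W →
               V ℤ.* V ℤ.+ W ℤ.* W ≡ U ℤ.* U ℤ.+ U ℤ.* U → + 4 ∣ U ℤ.* U ℤ.- V ℤ.* V
4∣-by-parity (even u) (even v) (even _) _ =
  divides (u ℤ.* u ℤ.- v ℤ.* v) (ℤ-Ring.solve (u ∷ v ∷ []))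
4∣-by-parity (odd u) (odd v) (odd _) _ =
  divides (u ℤ.* u ℤ.+ u ℤ.- v ℤ.* v ℤ.- v) (ℤ-Ring.solve (u ∷ v ∷ []))
4∣-by-parity {U} _ (even v) (odd w) eq =
  ⊥-elim (odd≢even (+ 2 ℤ.* (v ℤ.* v ℤ.+ w ℤ.* w ℤ.+ w)) (U ℤ.* U) (begin
    + 2 ℤ.* (+ 2 ℤ.* (v ℤ.* v ℤ.+ w ℤ.* w ℤ.+ w)) ℤ.+ 1ℤ                     ≡⟨ ℤ-Ring.solve (v ∷ w ∷ []) ⟩
    + 2 ℤ.* v ℤ.* (+ 2 ℤ.* v) ℤ.+ (+ 2 ℤ.* w ℤ.+ 1ℤ) ℤ.* (+ 2 ℤ.* w ℤ.+ 1ℤ) ≡⟨ eq ⟩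
    U ℤ.* U ℤ.+ U ℤ.* U                                                       ≡⟨ ℤ-Ring.solve (U ∷ []) ⟩
    + 2 ℤ.* (U ℤ.* U)                                                         ∎))
4∣-by-parity {U} _ (odd v) (even w) eq =
  ⊥-elim (odd≢even (+ 2 ℤ.* (v ℤ.* v ℤ.+ v ℤ.+ w ℤ.* w)) (U ℤ.* U) (begin
    + 2 ℤ.* (+ 2 ℤ.* (v ℤ.* v ℤ.+ v ℤ.+ w ℤ.* w)) ℤ.+ 1ℤ                     ≡⟨ ℤ-Ring.solve (v ∷ w ∷ []) ⟩
    (+ 2 ℤ.* v ℤ.+ 1ℤ) ℤ.* (+ 2 ℤ.* v ℤ.+ 1ℤ) ℤ.+ + 2 ℤ.* w ℤ.* (+ 2 ℤ.* w) ≡⟨ eq ⟩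
    U ℤ.* U ℤ.+ U ℤ.* U                                                       ≡⟨ ℤ-Ring.solve (U ∷ []) ⟩
    + 2 ℤ.* (U ℤ.* U)                                                         ∎))
4∣-by-parity (odd u) (even v) (even w) eq =
  ⊥-elim (odd≢even (+ 2 ℤ.* (u ℤ.* u ℤ.+ u)) (v ℤ.* v ℤ.+ w ℤ.* w) (sym (ℤ.*-cancelˡ-≡ (+ 2) _ _ (begin
    + 2 ℤ.* (+ 2 ℤ.* (v ℤ.* v ℤ.+ w ℤ.* w))                 ≡⟨ ℤ-Ring.solve (v ∷ w ∷ []) ⟩
    + 2 ℤ.* v ℤ.* (+ 2 ℤ.* v) ℤ.+ + 2 ℤ.* w ℤ.* (+ 2 ℤ.* w) ≡⟨ eq ⟩
    (+ 2 ℤ.* u ℤ.+ 1ℤ) ℤ.* (+ 2 ℤ.* u ℤ.+ 1ℤ) ℤ.+ (+ 2 ℤ.* u ℤ.+ 1ℤ) ℤ.* (+ 2 ℤ.* u ℤ.+ 1ℤ)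
                                                           ≡⟨ ℤ-Ring.solve (u ∷ []) ⟩
    + 2 ℤ.* (+ 2 ℤ.* (+ 2 ℤ.* (u ℤ.* u ℤ.+ u)) ℤ.+ 1ℤ)       ∎))))
4∣-by-parity (even u) (odd v) (odd w) eq =
  ⊥-elim (odd≢even (v ℤ.* v ℤ.+ v ℤ.+ w ℤ.* w ℤ.+ w) (+ 2 ℤ.* (u ℤ.* u)) (ℤ.*-cancelˡ-≡ (+ 2) _ _ (begin
    + 2 ℤ.* (+ 2 ℤ.* (v ℤ.* v ℤ.+ v ℤ.+ w ℤ.* w ℤ.+ w) ℤ.+ 1ℤ) ≡⟨ ℤ-Ring.solve (v ∷ w ∷ []) ⟩
    (+ 2 ℤ.* v ℤ.+ 1ℤ) ℤ.* (+ 2 ℤ.* v ℤ.+ 1ℤ) ℤ.+ (+ 2 ℤ.* w ℤ.+ 1ℤ) ℤ.* (+ 2 ℤ.* w ℤ.+ 1ℤ)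
                                                               ≡⟨ eq ⟩
    + 2 ℤ.* u ℤ.* (+ 2 ℤ.* u) ℤ.+ + 2 ℤ.* u ℤ.* (+ 2 ℤ.* u)     ≡⟨ ℤ-Ring.solve (u ∷ []) ⟩
    + 2 ℤ.* (+ 2 ℤ.* (+ 2 ℤ.* (u ℤ.* u)))                       ∎)))

squares-in-progression⇒4∣ : ∀ {a N} → IsSquareℤ (a ℤ.- N) → IsSquareℤ a → IsSquareℤ (a ℤ.+ N) →
                            + 4 ∣ N
squares-in-progression⇒4∣ {N = N} (V , V²≡U²-N) (U , refl) (W , W²≡U²+N) =
  subst (+ 4 ∣_) U²-V²≡N (4∣-by-parity (parity U) (parity V) (parity W) V²+W²≡2U²)
  where
  U²-V²≡N : U ℤ.* U ℤ.- V ℤ.* V ≡ N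
  U²-V²≡N = begin
    U ℤ.* U ℤ.- V ℤ.* V             ≡⟨ cong (λ v → U ℤ.* U ℤ.- v) V²≡U²-N ⟩
    U ℤ.* U ℤ.- (U ℤ.* U ℤ.- N)     ≡⟨ ℤ-Ring.solve (U ∷ N ∷ []) ⟩
    N                               ∎
  V²+W²≡2U² : V ℤ.* V ℤ.+ W ℤ.* W ≡ U ℤ.* U ℤ.+ U ℤ.* U
  V²+W²≡2U² = begin
    V ℤ.* V ℤ.+ W ℤ.* W                       ≡⟨ cong₂ ℤ._+_ V²≡U²-N W²≡U²+N ⟩
    (U ℤ.* U ℤ.- N) ℤ.+ (U ℤ.* U ℤ.+ N)       ≡⟨ ℤ-Ring.solve (U ∷ N ∷ []) ⟩
    U ℤ.* U ℤ.+ U ℤ.* U                       ∎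

squareFree⇒¬4∣ : ∀ {N} → SquareFree N → ¬ (+ 4 ∣ N)
squareFree⇒¬4∣ (_ , only-unit-squares) 4∣N with only-unit-squares (+ 2) (∣⇒∣ᵤ 4∣N)
... | ()

ι≡fromℤ : ∀ a → ι a ≡ fromℤ a
ι≡fromℤ a = ℚ.↥p/↧p≡p (fromℤ a)

ι-* : ∀ a b → ι a * ι b ≡ ι (a ℤ.* b)
ι-* a b rewrite ι≡fromℤ a | ι≡fromℤ b | ι≡fromℤ (a ℤ.* b) = refl

ι-+ : ∀ a b → ι a + ι b ≡ ι (a ℤ.+ b)
ι-+ a b rewrite ι≡fromℤ a | ι≡fromℤ b =
  ℚ./-cong {p₁ = a ℤ.* 1ℤ ℤ.+ b ℤ.* 1ℤ} (cong₂ ℤ._+_ (ℤ.*-identityʳ a) (ℤ.*-identityʳ b)) refl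

ι-neg : ∀ a → - ι a ≡ ι (ℤ.- a)
ι-neg a rewrite ι≡fromℤ a | ι≡fromℤ (ℤ.- a) with a
... | +0       = refl
... | +[1+ _ ] = refl
... | -[1+ _ ] = refl

ι-- : ∀ a b → ι a - ι b ≡ ι (a ℤ.- b)
ι-- a b = trans (cong (λ q → ι a + q) (ι-neg b)) (ι-+ a (ℤ.- b))

coprime-∣-square⇒≡1 : ∀ {d m} → Coprime d m → d ℕ.∣ m ℕ.* m → d ≡ 1
coprime-∣-square⇒≡1 d⊥m d∣m² = d⊥m (ℕ.∣-refl , coprime-divisor d⊥m d∣m²)

ℚ-square⇒ℤ-square : ∀ {a} → IsSquareℚ (ι a) → IsSquareℤ a
ℚ-square⇒ℤ-square {a} (q@(mkℚ n d n⊥D) , q²≡a) = n , (begin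
  n ℤ.* n                      ≡⟨ n²≡aD² ⟩
  a ℤ.* (+ suc d ℤ.* + suc d)  ≡⟨ cong (λ D → a ℤ.* (+ D ℤ.* + D)) D≡1 ⟩
  a ℤ.* 1ℤ                     ≡⟨ ℤ.*-identityʳ a ⟩
  a                            ∎)
  where
  n²≡aD² : n ℤ.* n ≡ a ℤ.* (+ suc d ℤ.* + suc d)
  n²≡aD² = trans (sym (ℤ.*-identityʳ (n ℤ.* n))) (ℚᵘ.drop-*≡* (ℚᵘ.≃-trans
    (ℚᵘ.≃-sym (ℚ.toℚᵘ-homo-* q q)) (ℚᵘ.≃-reflexive (cong ℚ.toℚᵘ (trans q²≡a (ι≡fromℤ a))))))
  D≡1 : suc d ≡ 1
  D≡1 = coprime-∣-square⇒≡1 (Coprimality.sym (recompute n⊥D))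
    (subst (suc d ℕ.∣_) (ℤ.abs-* n n) (∣⇒∣ᵤ (divides (a ℤ.* + suc d)
      (trans n²≡aD² (sym (ℤ.*-assoc a (+ suc d) (+ suc d)))))))

div-as-product : ∀ p q → q ≢ 0ℚ → ∃ λ t → div p q ≡ p * t × q * t ≡ 1ℚ
div-as-product p q q≢0 with q ≟ 0ℚ
... | yes q≡0 = ⊥-elim (q≢0 q≡0)
... | no q≢0' = 1/_ q {{≢-nonZero q≢0'}} , refl , ℚ.*-inverseʳ q {{≢-nonZero q≢0'}}

tangent-slope : ℤ → ℚ → ℚ → ℚ
tangent-slope N x y = div (ι (+ 3) * x * x + coefA N) (ι (+ 2) * y)

aff-injectiveˡ : ∀ {x y x′ y′} → aff x y ≡ aff x′ y′ → x ≡ x′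
aff-injectiveˡ refl = refl

doubling-abscissa : ∀ N x y {X Y} → add N (aff x y) (aff x y) ≡ aff X Y →
                    ι (+ 2) * y ≢ 0ℚ × X ≡ tangent-slope N x y * tangent-slope N x y - x - x
doubling-abscissa N x y eq with x ≟ x
... | no x≢x = ⊥-elim (x≢x refl)
... | yes _ with y + y ≟ 0ℚ
doubling-abscissa N x y () | yes _ | yes _
... | no 2y≢0 = 2y≢0 ∘ trans y+y≡2y , sym (aff-injectiveˡ eq)
  where
  y+y≡2y : y + y ≡ ι (+ 2) * y
  y+y≡2y = solve 1 (λ y → y :+ y := con (ι (+ 2)) :* y) refl y

shifted-abscissa-square :
  ∀ {x y n t L X} → y * y ≡ x * x * x - n * n * x → ι (+ 2) * y * t ≡ 1ℚ →
  X ≡ (L * t) * (L * t) - x - x →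
  ∀ c R → L * L - ι (+ 4) * (x + x - c) * (x * x * x - n * n * x) ≡ R * R →
  X + c ≡ (R * t) * (R * t)
shifted-abscissa-square {x} {y} {n} {t} {L} on-curve 2yt≡1 refl c R quartic≡R² = begin
  (L * t) * (L * t) - x - x + c
    ≡⟨ solve 4 (λ x t L c → (L :* t) :* (L :* t) :- x :- x :+ c
                         := L :* L :* (t :* t) :- (x :+ x :- c) :* con 1ℚ) refl x t L c ⟩
  L * L * (t * t) - (x + x - c) * 1ℚ
    ≡⟨ cong (λ e → L * L * (t * t) - (x + x - c) * e) (cong₂ _*_ 2yt≡1 2yt≡1) ⟨
  L * L * (t * t) - (x + x - c) * ((ι (+ 2) * y * t) * (ι (+ 2) * y * t))
    ≡⟨ solve 5 (λ x y t L c → L :* L :* (t :* t) :- (x :+ x :- c) :* ((con (ι (+ 2)) :* y :* t) :* (con (ι (+ 2)) :* y :* t))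
                             := (L :* L :- con (ι (+ 4)) :* (x :+ x :- c) :* (y :* y)) :* (t :* t))
               refl x y t L c ⟩
  (L * L - ι (+ 4) * (x + x - c) * (y * y)) * (t * t)
    ≡⟨ cong (λ e → (L * L - ι (+ 4) * (x + x - c) * e) * (t * t)) on-curve ⟩
  (L * L - ι (+ 4) * (x + x - c) * (x * x * x - n * n * x)) * (t * t)
    ≡⟨ cong (_* (t * t)) quartic≡R² ⟩
  R * R * (t * t)
    ≡⟨ solve 2 (λ R t → R :* R :* (t :* t) := (R :* t) :* (R :* t)) refl R t ⟩
  (R * t) * (R * t)
    ∎

abscissa-shifts-are-squares :
  ∀ {x y n t X} → y * y ≡ x * x * x - n * n * x → ι (+ 2) * y * t ≡ 1ℚ →
  X ≡ ((ι (+ 3) * x * x - n * n) * t) * ((ι (+ 3) * x * x - n * n) * t) - x - x →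
  IsSquareℚ (X - n) × IsSquareℚ X × IsSquareℚ (X + n)
abscissa-shifts-are-squares {x} {y} {n} {t} {X} on-curve 2yt≡1 X≡ =
    (R₋ * t , sym (shift (- n) R₋ quartic₋≡R₋²))
  , (R₀ * t , sym (trans (sym (ℚ.+-identityʳ X)) (shift 0ℚ R₀ quartic₀≡R₀²)))
  , (R₊ * t , sym (shift n R₊ quartic₊≡R₊²))
  where
  quartic : ℚ → ℚ
  quartic c = (ι (+ 3) * x * x - n * n) * (ι (+ 3) * x * x - n * n)
                - ι (+ 4) * (x + x - c) * (x * x * x - n * n * x)
  shift : ∀ c R → quartic c ≡ R * R → X + c ≡ (R * t) * (R * t)
  shift = shifted-abscissa-square {x} {y} {n} {t} {ι (+ 3) * x * x - n * n} on-curve 2yt≡1 X≡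
  R₋ R₀ R₊ : ℚ
  R₋ = x * x - ι (+ 2) * n * x - n * n
  R₀ = x * x + n * n
  R₊ = x * x + ι (+ 2) * n * x - n * n
  L cubic : ∀ {k} → Polynomial k → Polynomial k → Polynomial k
  L x n = con (ι (+ 3)) :* x :* x :- n :* n
  cubic x n = x :* x :* x :- n :* n :* x
  quartic₋≡R₋² : quartic (- n) ≡ R₋ * R₋
  quartic₋≡R₋² = solve 2 (λ x n →
    L x n :* L x n :- con (ι (+ 4)) :* (x :+ x :- :- n) :* cubic x n
      := (x :* x :- con (ι (+ 2)) :* n :* x :- n :* n) :* (x :* x :- con (ι (+ 2)) :* n :* x :- n :* n))
    refl x n
  quartic₀≡R₀² : quartic 0ℚ ≡ R₀ * R₀
  quartic₀≡R₀² = solve 2 (λ x n →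
    L x n :* L x n :- con (ι (+ 4)) :* (x :+ x :- con 0ℚ) :* cubic x n
      := (x :* x :+ n :* n) :* (x :* x :+ n :* n))
    refl x n
  quartic₊≡R₊² : quartic n ≡ R₊ * R₊
  quartic₊≡R₊² = solve 2 (λ x n →
    L x n :* L x n :- con (ι (+ 4)) :* (x :+ x :- n) :* cubic x n
      := (x :* x :+ con (ι (+ 2)) :* n :* x :- n :* n) :* (x :* x :+ con (ι (+ 2)) :* n :* x :- n :* n))
    refl x n

doubling-shifts-are-squares : ∀ N x y {X Y} → OnCurve N (aff x y) → add N (aff x y) (aff x y) ≡ aff X Y →
                              IsSquareℚ (X - ι N) × IsSquareℚ X × IsSquareℚ (X + ι N)
doubling-shifts-are-squares N x y {X} on-curve 2P≡ with doubling-abscissa N x y 2P≡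
... | 2y≢0 , X≡slope² with div-as-product (ι (+ 3) * x * x + coefA N) (ι (+ 2) * y) 2y≢0
... | t , slope≡ , 2yt≡1 = abscissa-shifts-are-squares {x} {y} {ι N} {t} on-curve′ 2yt≡1 X≡
  where
  n²≡ι[N²] : ι N * ι N ≡ ι (N ℤ.* N)
  n²≡ι[N²] = ι-* N N
  on-curve′ : y * y ≡ x * x * x - ι N * ι N * x
  on-curve′ = trans on-curve (cong (λ m → x * x * x - m * x) (sym n²≡ι[N²]))
  X≡ : X ≡ ((ι (+ 3) * x * x - ι N * ι N) * t) * ((ι (+ 3) * x * x - ι N * ι N) * t) - x - x
  X≡ = trans X≡slope² (cong (λ s → s * s - x - x)
         (trans slope≡ (cong (λ m → (ι (+ 3) * x * x + - m) * t) (sym n²≡ι[N²]))))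

lemma17 : (N : ℤ) → SquareFree N → (P : Point) → OnCurve N P →
    InfiniteOrder N P → ¬ Integral (mul N 2 P)
lemma17 _ _ O _ _ (_ , _ , ())
lemma17 N sf (aff x y) on-curve _ (a , b , 2P≡) =
  squareFree⇒¬4∣ sf (integer-squares (doubling-shifts-are-squares N x y {ι a} {ι b} on-curve 2P≡))
  where
  integer-squares : IsSquareℚ (ι a - ι N) × IsSquareℚ (ι a) × IsSquareℚ (ι a + ι N) → + 4 ∣ N
  integer-squares (a-N□ , a□ , a+N□) = squares-in-progression⇒4∣
    (ℚ-square⇒ℤ-square {a ℤ.- N} (subst IsSquareℚ (ι-- a N) a-N□))
    (ℚ-square⇒ℤ-square {a} a□)
    (ℚ-square⇒ℤ-square {a ℤ.+ N} (subst IsSquareℚ (ι-+ a N) a+N□))
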